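{- Let $h\ge1$ and $n\ge0$ be integers, and let $V$ be a random lattice path with $n$ steps in $\mathbb{N}_0^h$ as described in the context. Then for all $0\le t\le n$, $c\in\Omega_t$ and $1\le j\le h$, \[ \mathbb{P}(V_{\le t}\text{ ends in }c)=\frac1{|\Omega_t|}=\frac1{\binom{t+h-1}{h-1}}, \] and, for $t<n$, \[ \mathbb{P}(V_{\le t+1}\text{ ends in }c+e_j\mid V_{\le t}\text{ ends in }c)=\frac{c_j+1}{t+h}. \]
   Context: Lattice paths in $\mathbb{N}_0^h$ start at the origin and use the steps $e_1=(1,0,\dots,0)^\top,\dots,e_h=(0,\dots,0,1)^\top$. For a path $v$ with $n$ steps and $0\le t\le n$, $v_{\le t}$ is the path formed by its first $t$ steps; it ends in $\Omega_t=\{c\in\mathbb{N}_0^h : c_1+\dots+c_h=t\}$. The random path $V$ with $n$ steps is chosen so that all endpoints in $\Omega_n$ are equally likely, and, given the endpoint $c\in\Omega_n$, all lattice paths ending in $c$ are equally likely. -}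

module Defs where

open import Data.Bool using (Bool; true; false; _∧_; if_then_else_)
open import Data.Nat as ℕ using (ℕ; zero; suc; _+_; _*_)
open import Data.Fin using (Fin)
import Data.Fin.Properties as FinP
open import Data.List as List using (List; []; _∷_; length; filterᵇ; take; concatMap; upTo)
open import Data.Vec as Vec using (Vec; []; _∷_; lookup; updateAt; replicate)
import Data.Vec.Properties as VecP
open import Data.Integer using (+_)
open import Data.Rational as ℚ using (ℚ; 0ℚ; _÷_; ≢-nonZero)
import Data.Rational.Properties as ℚP
open import Relation.Nullary using (yes; no; does)
open import Relation.Binary.PropositionalEquality using (_≡_)

-- A lattice path in ℕ₀^h with n steps is encoded as its list of steps:
-- step j : Fin h stands for the unit vector e_j.
Path : ℕ → Set
Path h = List (Fin h)

paths : (h n : ℕ) → List (Path h)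
paths h zero    = [] ∷ []
paths h (suc n) = concatMap (λ v → List.map (_∷ v) (List.allFin h)) (paths h n)

e : ∀ {h} → Fin h → Vec ℕ h
e {h} j = updateAt (replicate h 0) j suc

endpoint : ∀ {h} → Path h → Vec ℕ h
endpoint {h} []      = replicate h 0
endpoint {h} (j ∷ v) = Vec.zipWith _+_ (e j) (endpoint v)

_≟ᵥ_ : ∀ {h} (c d : Vec ℕ h) → Bool
c ≟ᵥ d = does (VecP.≡-dec ℕ._≟_ c d)

prefix : ∀ {h} → ℕ → Path h → Path h
prefix t v = take t v

box : (h b : ℕ) → List (Vec ℕ h)
box zero    b = [] ∷ []
box (suc h) b = concatMap (λ k → List.map (k ∷_) (box h b)) (upTo (suc b))

-- Ω_t = { c ∈ ℕ₀^h : c₁+⋯+c_h = t }  (every such c lies in {0,…,t}^h)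
Ω : (h t : ℕ) → List (Vec ℕ h)
Ω h t = filterᵇ (λ c → does (Vec.sum c ℕ.≟ t)) (box h t)

_∈Ω_ : ∀ {h} → Vec ℕ h → ℕ → Set
c ∈Ω t = Vec.sum c ≡ t

-- a / d as a rational number (only used with d ≠ 0; value 0 if d = 0)
frac : ℕ → ℕ → ℚ
frac a zero    = 0ℚ
frac a (suc d) = (+ a) ℚ./ suc d

#pathsTo : ∀ {h} → ℕ → Vec ℕ h → ℕ
#pathsTo {h} n c = length (filterᵇ (λ w → endpoint w ≟ᵥ c) (paths h n))

-- The law of the random path V with n steps: endpoint uniform on Ω_n, and
-- given the endpoint c, uniform among the paths ending in c, i.e.
-- P(V = v) = 1/|Ω_n| · 1/#{paths ending in endpoint v}.
massV : (h n : ℕ) → Path h → ℚ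
massV h n v = frac 1 (length (Ω h n) * #pathsTo n (endpoint v))

sumℚ : List ℚ → ℚ
sumℚ = List.foldr ℚ._+_ 0ℚ

Pr : (h n : ℕ) → (Path h → Bool) → ℚ
Pr h n A = sumℚ (List.map (λ v → if A v then massV h n v else 0ℚ) (paths h n))

-- conditional probability P(A | B) = P(A ∩ B) / P(B)  (set to 0 if P(B) = 0)
PrCond : (h n : ℕ) → (Path h → Bool) → (Path h → Bool) → ℚ
PrCond h n A B with Pr h n B ℚP.≟ 0ℚ
... | yes _  = 0ℚ
... | no p≢0 = (Pr h n (λ v → A v ∧ B v) ÷ Pr h n B) {{≢-nonZero p≢0}}

endsIn : ∀ {h} → ℕ → Vec ℕ h → Path h → Bool
endsIn t c v = endpoint (prefix t v) ≟ᵥ c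

-- Under the law of V a single path v with n steps has probability
-- (h-1)! ∏ᵢ cᵢ! / (n+h-1)!, where c is its endpoint: the endpoint is uniform on
-- the C(n+h-1, h-1) points of Ω_n, and n! / ∏ᵢ cᵢ! paths end in c.  So V is a Pólya
-- urn with h colours, each starting with one ball.  Summing ∏ᵢ (c + endpoint w)ᵢ!
-- over the continuations w of length m of a prefix ending in c, with |c| = s, gives
-- ∏ᵢ cᵢ! (s+m+h-1)! / (s+h-1)!.  Hence P(V_{≤t} ends in c) is
-- #paths(c) ∏ᵢ cᵢ! (h-1)! / (t+h-1)! = t! (h-1)! / (t+h-1)! = 1/|Ω_t|, and the
-- transition probabilities are those of the urn, (c_j+1)/(t+h).

module Submission where

open import Defs
open import Data.Nat using (ℕ; _+_; _∸_; _≤_; _<_; suc)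
open import Data.Nat.Combinatorics using (_C_)
open import Data.Fin using (Fin)
open import Data.Vec using (Vec; lookup; zipWith)
open import Data.Product using (_×_)
open import Relation.Binary.PropositionalEquality using (_≡_)
open import Data.List using (length)

import Algebra.Properties.CommutativeSemigroup as CommSemigroupProperties
open import Data.Bool using (Bool; true; false; _∧_; if_then_else_)
open import Data.Fin as Fin using ()
import Data.Integer as ℤ
import Data.Integer.Properties as ℤP
import Data.Integer.Tactic.RingSolver as ℤ-Solver
open import Data.List as List using (List; []; _∷_; _++_; filterᵇ; concatMap; take; drop; allFin; upTo; applyUpTo)
import Data.List.Properties as Listₚ
open import Data.List.Relation.Unary.All as All using (All)
import Data.List.Relation.Unary.All.Properties as Allₚ
open import Data.Nat as ℕ using (zero; _*_; _!; pred; _≡ᵇ_; _≤ᵇ_; z≤n; s≤s; NonZero; ≢-nonZero)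
open import Data.Nat.Combinatorics using (nCn≡1; nCk+nC[k+1]≡[n+1]C[k+1]; nCk≡n!/k![n-k]!; k![n∸k]!∣n!)
open import Data.Nat.DivMod using (_/_; m/n*n≡m)
open import Data.Nat.Properties
open import Data.Nat.Tactic.RingSolver using (solve-∀)
open import Data.Rational as ℚ using (ℚ; 0ℚ; 1ℚ; _÷_)
import Data.Rational.Properties as ℚP
open import Data.Rational.Unnormalised as ℚᵘ using (mkℚᵘ; *≡*) renaming (_≃_ to _≃ᵘ_)
import Data.Rational.Unnormalised.Properties as ℚᵘP
open import Data.Vec using ([]; _∷_; replicate; updateAt; sum)
import Data.Vec.Properties as Vecₚ
open import Data.Product using (_,_)
open import Function using (_∘_)
open import Function.Definitions using (Injective)
open import Relation.Binary.Definitions using (DecidableEquality)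
open import Relation.Binary.PropositionalEquality
  using (_≢_; refl; sym; trans; cong; cong₂; subst; module ≡-Reasoning)
open import Relation.Nullary using (yes; no; does; contradiction)
open import Relation.Nullary.Decidable using (dec-true; dec-false)

module +-CS = CommSemigroupProperties +-commutativeSemigroup
module *-CS = CommSemigroupProperties *-commutativeSemigroup

if-∧ : ∀ {A : Set} a b (x y : A) → (if a ∧ b then x else y) ≡ (if b then (if a then x else y) else y)
if-∧ true  b     x y = refl
if-∧ false true  x y = refl
if-∧ false false x y = refl

nonZero-factor : ∀ m n {o} → m * n ≡ o → .{{NonZero o}} → NonZero m
nonZero-factor m n refl = m*n≢0⇒m≢0 m

∑ : {A : Set} → List A → (A → ℕ) → ℕ
∑ []       f = 0
∑ (x ∷ xs) f = f x + ∑ xs f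

syntax ∑ xs (λ x → t) = ∑[ x ∈ xs ] t

𝟙 : Bool → ℕ
𝟙 b = if b then 1 else 0

module _ {A : Set} where

  ∑-cong : ∀ xs {f g : A → ℕ} → (∀ x → f x ≡ g x) → ∑ xs f ≡ ∑ xs g
  ∑-cong []       f≗g = refl
  ∑-cong (x ∷ xs) f≗g = cong₂ _+_ (f≗g x) (∑-cong xs f≗g)

  ∑-≡0 : ∀ xs {f : A → ℕ} → (∀ x → f x ≡ 0) → ∑ xs f ≡ 0
  ∑-≡0 []       f≗0 = refl
  ∑-≡0 (x ∷ xs) f≗0 = cong₂ _+_ (f≗0 x) (∑-≡0 xs f≗0)

  ∑-++ : ∀ xs ys (f : A → ℕ) → ∑ (xs ++ ys) f ≡ ∑ xs f + ∑ ys f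
  ∑-++ []       ys f = refl
  ∑-++ (x ∷ xs) ys f = trans (cong (f x +_) (∑-++ xs ys f)) (sym (+-assoc (f x) _ _))

  ∑-+ : ∀ xs (f g : A → ℕ) → ∑[ x ∈ xs ] (f x + g x) ≡ ∑ xs f + ∑ xs g
  ∑-+ []       f g = refl
  ∑-+ (x ∷ xs) f g = trans (cong (f x + g x +_) (∑-+ xs f g)) (+-CS.interchange (f x) (g x) _ _)

  ∑-*ʳ : ∀ xs (f : A → ℕ) k → ∑[ x ∈ xs ] (f x * k) ≡ ∑ xs f * k
  ∑-*ʳ []       f k = refl
  ∑-*ʳ (x ∷ xs) f k = trans (cong (f x * k +_) (∑-*ʳ xs f k)) (sym (*-distribʳ-+ k (f x) _))

  ∑-*ˡ : ∀ xs (f : A → ℕ) k → ∑[ x ∈ xs ] (k * f x) ≡ k * ∑ xs f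
  ∑-*ˡ xs f k = trans (∑-cong xs (λ x → *-comm k (f x))) (trans (∑-*ʳ xs f k) (*-comm _ k))

  ∑-if : ∀ (p : A → Bool) xs k → ∑[ x ∈ xs ] (if p x then k else 0) ≡ length (filterᵇ p xs) * k
  ∑-if p []       k = refl
  ∑-if p (x ∷ xs) k with p x
  ... | true  = cong (k +_) (∑-if p xs k)
  ... | false = ∑-if p xs k

  length-filterᵇ : ∀ (p : A → Bool) xs → length (filterᵇ p xs) ≡ ∑[ x ∈ xs ] 𝟙 (p x)
  length-filterᵇ p xs = sym (trans (∑-if p xs 1) (*-identityʳ _))

module _ {A B : Set} where

  ∑-map : ∀ (g : A → B) xs f → ∑ (List.map g xs) f ≡ ∑[ x ∈ xs ] f (g x)
  ∑-map g []       f = refl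
  ∑-map g (x ∷ xs) f = cong (f (g x) +_) (∑-map g xs f)

  ∑-concatMap : ∀ (g : A → List B) xs f → ∑ (concatMap g xs) f ≡ ∑[ x ∈ xs ] ∑ (g x) f
  ∑-concatMap g []       f = refl
  ∑-concatMap g (x ∷ xs) f = trans (∑-++ (g x) _ f) (cong (∑ (g x) f +_) (∑-concatMap g xs f))

  ∑-comm : ∀ xs ys (f : A → B → ℕ) → ∑[ x ∈ xs ] ∑ ys (f x) ≡ ∑[ y ∈ ys ] ∑[ x ∈ xs ] f x y
  ∑-comm []       ys f = sym (∑-≡0 ys (λ _ → refl))
  ∑-comm (x ∷ xs) ys f =
    trans (cong (∑ ys (f x) +_) (∑-comm xs ys f)) (sym (∑-+ ys (f x) (λ y → ∑[ x ∈ xs ] f x y)))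

∑-allFin-suc : ∀ n (f : Fin (suc n) → ℕ) →
               ∑ (allFin (suc n)) f ≡ f Fin.zero + ∑[ i ∈ allFin n ] f (Fin.suc i)
∑-allFin-suc n f = cong (f Fin.zero +_)
  (trans (cong (λ is → ∑ is f) (sym (Listₚ.map-tabulate (λ i → i) Fin.suc))) (∑-map Fin.suc (allFin n) f))

∑-lookup : ∀ {n} (d : Vec ℕ n) → ∑ (allFin n) (lookup d) ≡ sum d
∑-lookup []      = refl
∑-lookup (x ∷ d) = trans (∑-allFin-suc _ (lookup (x ∷ d))) (cong (x +_) (∑-lookup d))

∑-suc-lookup : ∀ {n} (d : Vec ℕ n) → ∑[ i ∈ allFin n ] suc (lookup d i) ≡ n + sum d
∑-suc-lookup []      = refl
∑-suc-lookup {suc n} (x ∷ d) = trans (∑-allFin-suc n (λ i → suc (lookup (x ∷ d) i)))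
  (cong suc (trans (cong (x +_) (∑-suc-lookup d)) (+-CS.x∙yz≈y∙xz x n (sum d))))

∑-pick : ∀ {n} (j : Fin n) (f : Fin n → ℕ) →
         ∑[ i ∈ allFin n ] (if does (i Fin.≟ j) then f i else 0) ≡ f j
∑-pick {suc n} Fin.zero f = trans (∑-allFin-suc n (λ i → if does (i Fin.≟ Fin.zero) then f i else 0))
  (trans (cong (f Fin.zero +_) (∑-≡0 (allFin n) (λ _ → refl))) (+-identityʳ _))
∑-pick (Fin.suc j) f =
  trans (∑-allFin-suc _ (λ i → if does (i Fin.≟ Fin.suc j) then f i else 0)) (∑-pick j (f ∘ Fin.suc))

∑-applyUpTo : ∀ {A : Set} (g : ℕ → A) n f → ∑ (applyUpTo g n) f ≡ ∑[ k ∈ upTo n ] f (g k)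
∑-applyUpTo g zero    f = refl
∑-applyUpTo g (suc n) f =
  cong (f (g 0) +_) (trans (∑-applyUpTo (g ∘ suc) n f) (sym (∑-applyUpTo suc n (f ∘ g))))

toℚᵘ-frac : ∀ a d → ℚ.toℚᵘ (frac a (suc d)) ≃ᵘ mkℚᵘ (ℤ.+ a) d
toℚᵘ-frac a d = ℚP.toℚᵘ-fromℚᵘ (mkℚᵘ (ℤ.+ a) d)

frac-cross : ∀ a b d d′ .{{_ : NonZero d}} .{{_ : NonZero d′}} →
             a * d′ ≡ b * d → frac a d ≡ frac b d′
frac-cross a b (suc d) (suc d′) eq = ℚP.fromℚᵘ-cong {mkℚᵘ (ℤ.+ a) d} {mkℚᵘ (ℤ.+ b) d′} (*≡* (begin
  ℤ.+ a ℤ.* ℤ.+ suc d′  ≡⟨ ℤP.pos-* a (suc d′) ⟨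
  ℤ.+ (a * suc d′)    ≡⟨ cong ℤ.+_ eq ⟩
  ℤ.+ (b * suc d)     ≡⟨ ℤP.pos-* b (suc d) ⟩
  ℤ.+ b ℤ.* ℤ.+ suc d   ∎))
  where open ≡-Reasoning

frac-+ : ∀ a b d .{{_ : NonZero d}} → frac a d ℚ.+ frac b d ≡ frac (a + b) d
frac-+ a b (suc d) = ℚP.toℚᵘ-injective (begin
    ℚ.toℚᵘ (frac a (suc d) ℚ.+ frac b (suc d))
  ≈⟨ ℚP.toℚᵘ-homo-+ (frac a (suc d)) (frac b (suc d)) ⟩
    ℚ.toℚᵘ (frac a (suc d)) ℚᵘ.+ ℚ.toℚᵘ (frac b (suc d))
  ≈⟨ ℚᵘP.+-cong (toℚᵘ-frac a d) (toℚᵘ-frac b d) ⟩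
    mkℚᵘ (ℤ.+ a) d ℚᵘ.+ mkℚᵘ (ℤ.+ b) d
  ≈⟨ *≡* (trans (distrib (ℤ.+ a) (ℤ.+ b) (ℤ.+ suc d))
            (sym (cong₂ ℤ._*_ (ℤP.pos-+ a b) (ℤP.pos-* (suc d) (suc d))))) ⟩
    mkℚᵘ (ℤ.+ (a + b)) d
  ≈⟨ toℚᵘ-frac (a + b) d ⟨
    ℚ.toℚᵘ (frac (a + b) (suc d)) ∎)
  where
  open ℚᵘP.≃-Reasoning
  distrib : ∀ x y z → (x ℤ.* z ℤ.+ y ℤ.* z) ℤ.* z ≡ (x ℤ.+ y) ℤ.* (z ℤ.* z)
  distrib = ℤ-Solver.solve-∀

frac-* : ∀ a b d d′ .{{_ : NonZero d}} .{{_ : NonZero d′}} →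
         frac a d ℚ.* frac b d′ ≡ frac (a * b) (d * d′)
frac-* a b (suc d) (suc d′) = ℚP.toℚᵘ-injective (begin
    ℚ.toℚᵘ (frac a (suc d) ℚ.* frac b (suc d′))
  ≈⟨ ℚP.toℚᵘ-homo-* (frac a (suc d)) (frac b (suc d′)) ⟩
    ℚ.toℚᵘ (frac a (suc d)) ℚᵘ.* ℚ.toℚᵘ (frac b (suc d′))
  ≈⟨ ℚᵘP.*-cong (toℚᵘ-frac a d) (toℚᵘ-frac b d′) ⟩
    mkℚᵘ (ℤ.+ a) d ℚᵘ.* mkℚᵘ (ℤ.+ b) d′
  ≈⟨ *≡* (cong (ℤ._* ℤ.+ (suc d * suc d′)) (sym (ℤP.pos-* a b))) ⟩
    mkℚᵘ (ℤ.+ (a * b)) _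
  ≈⟨ toℚᵘ-frac (a * b) _ ⟨
    ℚ.toℚᵘ (frac (a * b) (suc d * suc d′)) ∎)
  where open ℚᵘP.≃-Reasoning

frac-0 : ∀ d → frac 0 d ≡ 0ℚ
frac-0 zero    = refl
frac-0 (suc d) = ℚP.0/n≡0 (suc d)

frac-1≢0 : ∀ d .{{_ : NonZero d}} → frac 1 d ≢ 0ℚ
frac-1≢0 (suc d) eq with ℚP.fromℚᵘ-injective {mkℚᵘ (ℤ.+ 1) d} {mkℚᵘ (ℤ.+ 0) 0} eq
... | *≡* ()

÷-unique : ∀ x y q .{{_ : ℚ.NonZero y}} → x ≡ q ℚ.* y → x ÷ y ≡ q
÷-unique x y q eq = begin
  x ℚ.* ℚ.1/ y          ≡⟨ cong (ℚ._* ℚ.1/ y) eq ⟩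
  q ℚ.* y ℚ.* ℚ.1/ y    ≡⟨ ℚP.*-assoc q y (ℚ.1/ y) ⟩
  q ℚ.* (y ℚ.* ℚ.1/ y)  ≡⟨ cong (q ℚ.*_) (ℚP.*-inverseʳ y) ⟩
  q ℚ.* 1ℚ              ≡⟨ ℚP.*-identityʳ q ⟩
  q                     ∎
  where open ≡-Reasoning

sumℚ-frac : ∀ {A : Set} d .{{_ : NonZero d}} xs (f : A → ℕ) →
            sumℚ (List.map (λ x → frac (f x) d) xs) ≡ frac (∑ xs f) d
sumℚ-frac d []       f = sym (frac-0 d)
sumℚ-frac d (x ∷ xs) f = trans (cong (frac (f x) d ℚ.+_) (sumℚ-frac d xs f)) (frac-+ (f x) (∑ xs f) d)

PrCond-≡ : ∀ {h} n (A B : Path h → Bool) q → Pr h n B ≢ 0ℚ →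
           Pr h n (λ v → A v ∧ B v) ≡ q ℚ.* Pr h n B → PrCond h n A B ≡ q
PrCond-≡ {h} n A B q PrB≢0 PrAB≡ with Pr h n B ℚP.≟ 0ℚ
... | yes PrB≡0 = contradiction PrB≡0 PrB≢0
... | no  PrB≢0 = ÷-unique _ _ q {{ℚ.≢-nonZero PrB≢0}} PrAB≡

does-≟-injective : ∀ {A B : Set} (_≟ᴬ_ : DecidableEquality A) (_≟ᴮ_ : DecidableEquality B)
                   (f : A → B) → Injective _≡_ _≡_ f → ∀ x y → does (f x ≟ᴮ f y) ≡ does (x ≟ᴬ y)
does-≟-injective _≟ᴬ_ _≟ᴮ_ f f-inj x y with x ≟ᴬ y
... | yes refl = dec-true (f x ≟ᴮ f x) refl
... | no  x≢y  = dec-false (f x ≟ᴮ f y) (x≢y ∘ f-inj)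

≟ᵥ-refl : ∀ {h} (c : Vec ℕ h) → (c ≟ᵥ c) ≡ true
≟ᵥ-refl c = dec-true (Vecₚ.≡-dec ℕ._≟_ c c) refl

≟ᵥ⇒≡ : ∀ {h} {c d : Vec ℕ h} → (c ≟ᵥ d) ≡ true → c ≡ d
≟ᵥ⇒≡ {c = c} {d} eq with Vecₚ.≡-dec ℕ._≟_ c d
... | yes c≡d = c≡d

≢⇒≟ᵥ-false : ∀ {h} {c d : Vec ℕ h} → c ≢ d → (c ≟ᵥ d) ≡ false
≢⇒≟ᵥ-false {c = c} {d} = dec-false (Vecₚ.≡-dec ℕ._≟_ c d)

≟ᵥ-injective : ∀ {h h′} (f : Vec ℕ h → Vec ℕ h′) → Injective _≡_ _≡_ f →
               ∀ c d → (f c ≟ᵥ f d) ≡ (c ≟ᵥ d)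
≟ᵥ-injective f f-inj = does-≟-injective (Vecₚ.≡-dec ℕ._≟_) (Vecₚ.≡-dec ℕ._≟_) f f-inj

infixl 6 _⊕_
_⊕_ : ∀ {h} → Vec ℕ h → Vec ℕ h → Vec ℕ h
_⊕_ = zipWith _+_

module _ {h : ℕ} where

  ⊕-identityˡ : ∀ (c : Vec ℕ h) → replicate h 0 ⊕ c ≡ c
  ⊕-identityˡ = Vecₚ.zipWith-identityˡ +-identityˡ

  ⊕-identityʳ : ∀ (c : Vec ℕ h) → c ⊕ replicate h 0 ≡ c
  ⊕-identityʳ = Vecₚ.zipWith-identityʳ +-identityʳ

  ⊕-comm : ∀ (c d : Vec ℕ h) → c ⊕ d ≡ d ⊕ c
  ⊕-comm = Vecₚ.zipWith-comm +-comm

  ⊕-assoc : ∀ (b c d : Vec ℕ h) → b ⊕ c ⊕ d ≡ b ⊕ (c ⊕ d)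
  ⊕-assoc = Vecₚ.zipWith-assoc +-assoc

⊕-cancelˡ : ∀ {h} (b : Vec ℕ h) → Injective _≡_ _≡_ (b ⊕_)
⊕-cancelˡ []      {[]}    {[]}    _  = refl
⊕-cancelˡ (x ∷ b) {y ∷ c} {z ∷ d} eq =
  cong₂ _∷_ (+-cancelˡ-≡ x y z (Vecₚ.∷-injectiveˡ eq)) (⊕-cancelˡ b (Vecₚ.∷-injectiveʳ eq))

e-injective : ∀ {h} → Injective _≡_ _≡_ (e {h})
e-injective {x = Fin.zero}  {Fin.zero}  _  = refl
e-injective {x = Fin.suc i} {Fin.suc j} eq = cong Fin.suc (e-injective (Vecₚ.∷-injectiveʳ eq))

lookup-e⊕ : ∀ {h} (j : Fin h) (c : Vec ℕ h) → lookup (e j ⊕ c) j ≡ suc (lookup c j)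
lookup-e⊕ Fin.zero    (x ∷ c) = refl
lookup-e⊕ (Fin.suc j) (x ∷ c) = lookup-e⊕ j c

sum-e⊕ : ∀ {h} (j : Fin h) (c : Vec ℕ h) → sum (e j ⊕ c) ≡ suc (sum c)
sum-e⊕ Fin.zero    (x ∷ c) = cong (λ d → suc x + sum d) (⊕-identityˡ c)
sum-e⊕ (Fin.suc j) (x ∷ c) = trans (cong (x +_) (sum-e⊕ j c)) (+-suc x (sum c))

sum-⊕e : ∀ {h} (c : Vec ℕ h) (j : Fin h) → sum (c ⊕ e j) ≡ suc (sum c)
sum-⊕e c j = trans (cong sum (⊕-comm c (e j))) (sum-e⊕ j c)

sum-0ᵥ : ∀ h → sum (replicate h 0) ≡ 0
sum-0ᵥ zero    = refl
sum-0ᵥ (suc h) = sum-0ᵥ h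

sum≡0⇒≡0ᵥ : ∀ {h} (c : Vec ℕ h) → sum c ≡ 0 → c ≡ replicate h 0
sum≡0⇒≡0ᵥ []           _  = refl
sum≡0⇒≡0ᵥ (zero ∷ c) eq = cong (0 ∷_) (sum≡0⇒≡0ᵥ c eq)

e⊕-updateAt-pred : ∀ {h} (j : Fin h) (d : Vec ℕ h) {k} → lookup d j ≡ suc k → e j ⊕ updateAt d j pred ≡ d
e⊕-updateAt-pred Fin.zero    (suc x ∷ d) _  = cong (suc x ∷_) (⊕-identityˡ d)
e⊕-updateAt-pred (Fin.suc j) (x ∷ d)     eq = cong (x ∷_) (e⊕-updateAt-pred j d eq)

∏! : ∀ {h} → Vec ℕ h → ℕ
∏! []      = 1
∏! (x ∷ c) = x ! * ∏! c

∏!-0ᵥ : ∀ h → ∏! (replicate h 0) ≡ 1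
∏!-0ᵥ zero    = refl
∏!-0ᵥ (suc h) = trans (+-identityʳ _) (∏!-0ᵥ h)

∏!-e⊕ : ∀ {h} (j : Fin h) (c : Vec ℕ h) → ∏! (e j ⊕ c) ≡ suc (lookup c j) * ∏! c
∏!-e⊕ Fin.zero    (x ∷ c) =
  trans (cong (λ d → suc x ! * ∏! d) (⊕-identityˡ c)) (*-assoc (suc x) (x !) (∏! c))
∏!-e⊕ (Fin.suc j) (x ∷ c) =
  trans (cong (x ! *_) (∏!-e⊕ j c)) (*-CS.x∙yz≈y∙xz (x !) (suc (lookup c j)) (∏! c))

∏!-⊕e : ∀ {h} (c : Vec ℕ h) (j : Fin h) → ∏! (c ⊕ e j) ≡ suc (lookup c j) * ∏! c
∏!-⊕e c j = trans (cong ∏! (⊕-comm c (e j))) (∏!-e⊕ j c)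

∑-∏!-⊕e : ∀ {h} (c : Vec ℕ h) → ∑[ j ∈ allFin h ] ∏! (c ⊕ e j) ≡ (h + sum c) * ∏! c
∑-∏!-⊕e {h} c = begin
  ∑[ j ∈ allFin h ] ∏! (c ⊕ e j)             ≡⟨ ∑-cong (allFin h) (∏!-⊕e c) ⟩
  ∑[ j ∈ allFin h ] (suc (lookup c j) * ∏! c) ≡⟨ ∑-*ʳ (allFin h) (suc ∘ lookup c) (∏! c) ⟩
  ∑[ j ∈ allFin h ] suc (lookup c j) * ∏! c   ≡⟨ cong (_* ∏! c) (∑-suc-lookup c) ⟩
  (h + sum c) * ∏! c                          ∎
  where open ≡-Reasoning

⊕e-≟ᵥ : ∀ {h} (c : Vec ℕ h) (i j : Fin h) → ((c ⊕ e i) ≟ᵥ (c ⊕ e j)) ≡ does (i Fin.≟ j)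
⊕e-≟ᵥ c =
  does-≟-injective Fin._≟_ (Vecₚ.≡-dec ℕ._≟_) (λ i → c ⊕ e i) (e-injective ∘ ⊕-cancelˡ c)

-- Lattice paths

take-suc-++ : ∀ {A : Set} t (v : List A) → take (suc t) v ≡ take t v ++ take 1 (drop t v)
take-suc-++ zero    v       = refl
take-suc-++ (suc t) []      = refl
take-suc-++ (suc t) (x ∷ v) = cong (x ∷_) (take-suc-++ t v)

module _ {h : ℕ} where

  endpoint-++ : ∀ (u w : Path h) → endpoint (u ++ w) ≡ endpoint u ⊕ endpoint w
  endpoint-++ []      w = sym (⊕-identityˡ (endpoint w))
  endpoint-++ (j ∷ u) w = trans (cong (e j ⊕_) (endpoint-++ u w)) (sym (⊕-assoc (e j) (endpoint u) (endpoint w)))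

  endpoint-take-drop : ∀ t (v : Path h) → endpoint v ≡ endpoint (take t v) ⊕ endpoint (drop t v)
  endpoint-take-drop t v = trans (cong endpoint (sym (Listₚ.take++drop≡id t v))) (endpoint-++ (take t v) (drop t v))

  sum-endpoint : ∀ (v : Path h) → sum (endpoint v) ≡ length v
  sum-endpoint []      = sum-0ᵥ h
  sum-endpoint (j ∷ v) = trans (sum-e⊕ j (endpoint v)) (cong suc (sum-endpoint v))

  paths-length : ∀ n → All (λ v → length v ≡ n) (paths h n)
  paths-length zero    = refl All.∷ All.[]
  paths-length (suc n) = Allₚ.concat⁺ (Allₚ.map⁺ (All.map extend (paths-length n)))
    where
    extend : ∀ {v} → length v ≡ n → All (λ v′ → length v′ ≡ suc n) (List.map (_∷ v) (allFin h))
    extend |v|≡n = Allₚ.map⁺ (All.universal (λ _ → cong suc |v|≡n) (allFin h))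

  ∑-paths-suc : ∀ m (f : Path h → ℕ) →
                ∑ (paths h (suc m)) f ≡ ∑[ v ∈ paths h m ] ∑[ j ∈ allFin h ] f (j ∷ v)
  ∑-paths-suc m f =
    trans (∑-concatMap _ (paths h m) f) (∑-cong (paths h m) (λ v → ∑-map (_∷ v) (allFin h) f))

  ∑-paths-+ : ∀ t m (f : Path h → Path h → ℕ) →
              ∑[ v ∈ paths h (t + m) ] f (take t v) (drop t v) ≡ ∑[ u ∈ paths h t ] ∑[ w ∈ paths h m ] f u w
  ∑-paths-+ zero    m f = sym (+-identityʳ _)
  ∑-paths-+ (suc t) m f = begin
      ∑[ v ∈ paths h (suc t + m) ] f (take (suc t) v) (drop (suc t) v)
    ≡⟨ ∑-paths-suc (t + m) _ ⟩
      ∑[ v ∈ paths h (t + m) ] ∑[ j ∈ allFin h ] f (j ∷ take t v) (drop t v)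
    ≡⟨ ∑-paths-+ t m (λ u w → ∑[ j ∈ allFin h ] f (j ∷ u) w) ⟩
      ∑[ u ∈ paths h t ] ∑[ w ∈ paths h m ] ∑[ j ∈ allFin h ] f (j ∷ u) w
    ≡⟨ ∑-cong (paths h t) (λ u → ∑-comm (paths h m) (allFin h) (λ w j → f (j ∷ u) w)) ⟩
      ∑[ u ∈ paths h t ] ∑[ j ∈ allFin h ] ∑[ w ∈ paths h m ] f (j ∷ u) w
    ≡⟨ ∑-paths-suc t _ ⟨
      ∑[ u ∈ paths h (suc t) ] ∑[ w ∈ paths h m ] f u w
    ∎
    where open ≡-Reasoning

  ∑-endsIn : ∀ t m (c : Vec ℕ h) (f : Vec ℕ h → Path h → ℕ) →
             ∑[ v ∈ paths h (t + m) ] (if endsIn t c v then f (endpoint (take t v)) (drop t v) else 0)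
               ≡ #pathsTo t c * ∑[ w ∈ paths h m ] f c w
  ∑-endsIn t m c f = begin
      ∑[ v ∈ paths h (t + m) ] (if endsIn t c v then f (endpoint (take t v)) (drop t v) else 0)
    ≡⟨ ∑-paths-+ t m (λ u w → if endpoint u ≟ᵥ c then f (endpoint u) w else 0) ⟩
      ∑[ u ∈ paths h t ] ∑[ w ∈ paths h m ] (if endpoint u ≟ᵥ c then f (endpoint u) w else 0)
    ≡⟨ ∑-cong (paths h t) restrict ⟩
      ∑[ u ∈ paths h t ] (if endpoint u ≟ᵥ c then ∑[ w ∈ paths h m ] f c w else 0)
    ≡⟨ ∑-if (λ u → endpoint u ≟ᵥ c) (paths h t) _ ⟩
      #pathsTo t c * ∑[ w ∈ paths h m ] f c w
    ∎
    where
    open ≡-Reasoning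
    restrict : ∀ u → ∑[ w ∈ paths h m ] (if endpoint u ≟ᵥ c then f (endpoint u) w else 0)
                       ≡ (if endpoint u ≟ᵥ c then ∑[ w ∈ paths h m ] f c w else 0)
    restrict u with endpoint u ≟ᵥ c in eq
    ... | true  = ∑-cong (paths h m) (λ w → cong (λ x → f x w) (≟ᵥ⇒≡ eq))
    ... | false = ∑-≡0 (paths h m) (λ _ → refl)

  ∑-first-step-≟ᵥ : ∀ t j (d : Vec ℕ h) k →
    ∑[ w ∈ paths h t ] (if (e j ⊕ endpoint w) ≟ᵥ (e j ⊕ d) then k else 0) ≡ #pathsTo t d * k
  ∑-first-step-≟ᵥ t j d k = trans
    (∑-cong (paths h t) (λ w → cong (λ b → if b then k else 0)
      (≟ᵥ-injective (e j ⊕_) (⊕-cancelˡ (e j)) (endpoint w) d)))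
    (∑-if (λ w → endpoint w ≟ᵥ d) (paths h t) k)

  ∑-first-step-≟ᵥ-0 : ∀ t j (d : Vec ℕ h) k → lookup d j ≡ 0 →
    ∑[ w ∈ paths h t ] (if (e j ⊕ endpoint w) ≟ᵥ d then k else 0) ≡ 0
  ∑-first-step-≟ᵥ-0 t j d k dⱼ≡0 =
    ∑-≡0 (paths h t) (λ w → cong (λ b → if b then k else 0) (≢⇒≟ᵥ-false (missed w)))
    where
    missed : ∀ w → e j ⊕ endpoint w ≢ d
    missed w eq =
      0≢1+n (trans (sym dⱼ≡0) (trans (cong (λ x → lookup x j) (sym eq)) (lookup-e⊕ j (endpoint w))))

  #pathsTo-multinomial : ∀ t (d : Vec ℕ h) → sum d ≡ t → #pathsTo t d * ∏! d ≡ t !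
  #pathsTo-multinomial zero d |d|≡0 rewrite sum≡0⇒≡0ᵥ d |d|≡0 | ≟ᵥ-refl (replicate h 0) =
    trans (+-identityʳ _) (∏!-0ᵥ h)
  #pathsTo-multinomial (suc t) d |d|≡1+t = begin
      #pathsTo (suc t) d * ∏! d
    ≡⟨ ∑-if (λ w → endpoint w ≟ᵥ d) (paths h (suc t)) (∏! d) ⟨
      ∑[ w ∈ paths h (suc t) ] (if endpoint w ≟ᵥ d then ∏! d else 0)
    ≡⟨ ∑-paths-suc t _ ⟩
      ∑[ w ∈ paths h t ] ∑[ j ∈ allFin h ] (if (e j ⊕ endpoint w) ≟ᵥ d then ∏! d else 0)
    ≡⟨ ∑-comm (paths h t) (allFin h) (λ w j → if (e j ⊕ endpoint w) ≟ᵥ d then ∏! d else 0) ⟩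
      ∑[ j ∈ allFin h ] ∑[ w ∈ paths h t ] (if (e j ⊕ endpoint w) ≟ᵥ d then ∏! d else 0)
    ≡⟨ ∑-cong (allFin h) first-step ⟩
      ∑[ j ∈ allFin h ] (lookup d j * t !)
    ≡⟨ ∑-*ʳ (allFin h) (lookup d) (t !) ⟩
      ∑ (allFin h) (lookup d) * t !
    ≡⟨ cong (_* t !) (trans (∑-lookup d) |d|≡1+t) ⟩
      suc t * t !
    ∎
    where
    open ≡-Reasoning
    first-step : ∀ j →
      ∑[ w ∈ paths h t ] (if (e j ⊕ endpoint w) ≟ᵥ d then ∏! d else 0) ≡ lookup d j * t !
    first-step j with lookup d j in dⱼ≡
    ... | zero  = ∑-first-step-≟ᵥ-0 t j d (∏! d) dⱼ≡
    ... | suc k = begin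
        ∑[ w ∈ paths h t ] (if (e j ⊕ endpoint w) ≟ᵥ d then ∏! d else 0)
      ≡⟨ cong (λ x → ∑[ w ∈ paths h t ] (if (e j ⊕ endpoint w) ≟ᵥ x then ∏! d else 0)) (sym d≡) ⟩
        ∑[ w ∈ paths h t ] (if (e j ⊕ endpoint w) ≟ᵥ (e j ⊕ d′) then ∏! d else 0)
      ≡⟨ ∑-first-step-≟ᵥ t j d′ (∏! d) ⟩
        #pathsTo t d′ * ∏! d
      ≡⟨ cong (#pathsTo t d′ *_) (trans (cong ∏! (sym d≡)) (∏!-e⊕ j d′)) ⟩
        #pathsTo t d′ * (suc (lookup d′ j) * ∏! d′)
      ≡⟨ *-CS.x∙yz≈y∙xz (#pathsTo t d′) (suc (lookup d′ j)) (∏! d′) ⟩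
        suc (lookup d′ j) * (#pathsTo t d′ * ∏! d′)
      ≡⟨ cong₂ _*_ d′ⱼ≡ (#pathsTo-multinomial t d′ |d′|≡t) ⟩
        suc k * t !
      ∎
      where
      d′ : Vec ℕ h
      d′ = updateAt d j pred
      d≡ : e j ⊕ d′ ≡ d
      d≡ = e⊕-updateAt-pred j d dⱼ≡
      d′ⱼ≡ : suc (lookup d′ j) ≡ suc k
      d′ⱼ≡ = trans (sym (lookup-e⊕ j d′)) (trans (cong (λ x → lookup x j) d≡) dⱼ≡)
      |d′|≡t : sum d′ ≡ t
      |d′|≡t = suc-injective (trans (sym (sum-e⊕ j d′)) (trans (cong sum d≡) |d|≡1+t))

-- The number of points of Ω_t

𝟙-≤ᵇ-zero : ∀ s → 𝟙 (s ≤ᵇ 0) ≡ 𝟙 (s ≡ᵇ 0)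
𝟙-≤ᵇ-zero zero    = refl
𝟙-≤ᵇ-zero (suc s) = refl

𝟙-≤ᵇ-suc : ∀ s t → 𝟙 (s ≤ᵇ suc t) ≡ 𝟙 (s ≤ᵇ t) + 𝟙 (s ≡ᵇ suc t)
𝟙-≤ᵇ-suc zero          t       = refl
𝟙-≤ᵇ-suc (suc zero)    zero    = refl
𝟙-≤ᵇ-suc (suc (suc s)) zero    = refl
𝟙-≤ᵇ-suc (suc zero)    (suc t) = refl
𝟙-≤ᵇ-suc (suc (suc s)) (suc t) = 𝟙-≤ᵇ-suc (suc s) t

∑-upTo-𝟙 : ∀ t b s → t ≤ b → ∑[ k ∈ upTo (suc b) ] 𝟙 (k + s ≡ᵇ t) ≡ 𝟙 (s ≤ᵇ t)
∑-upTo-𝟙 zero b s _ =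
  trans (cong (𝟙 (s ≡ᵇ 0) +_) (trans (∑-applyUpTo suc b _) (∑-≡0 (upTo b) (λ _ → refl))))
  (trans (+-identityʳ _) (sym (𝟙-≤ᵇ-zero s)))
∑-upTo-𝟙 (suc t) (suc b) s (s≤s t≤b) =
  trans (cong (𝟙 (s ≡ᵇ suc t) +_) (trans (∑-applyUpTo suc (suc b) _) (∑-upTo-𝟙 t b s t≤b)))
  (trans (+-comm (𝟙 (s ≡ᵇ suc t)) (𝟙 (s ≤ᵇ t))) (sym (𝟙-≤ᵇ-suc s t)))

-- Ω h t is box h t filtered; the recursion of box over h keeps the bound b fixed,
-- so the count is generalised to an arbitrary bound b ≥ t.
#box : (h b t : ℕ) → ℕ
#box h b t = length (filterᵇ (λ c → sum c ≡ᵇ t) (box h b))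

#box-suc : ∀ h b t → t ≤ b → #box (suc h) b t ≡ ∑[ c ∈ box h b ] 𝟙 (sum c ≤ᵇ t)
#box-suc h b t t≤b = begin
    #box (suc h) b t
  ≡⟨ length-filterᵇ (λ c → sum c ≡ᵇ t) (box (suc h) b) ⟩
    ∑[ c ∈ box (suc h) b ] 𝟙 (sum c ≡ᵇ t)
  ≡⟨ ∑-concatMap (λ k → List.map (k ∷_) (box h b)) (upTo (suc b)) _ ⟩
    ∑[ k ∈ upTo (suc b) ] ∑[ c ∈ List.map (k ∷_) (box h b) ] 𝟙 (sum c ≡ᵇ t)
  ≡⟨ ∑-cong (upTo (suc b)) (λ k → ∑-map (k ∷_) (box h b) _) ⟩
    ∑[ k ∈ upTo (suc b) ] ∑[ c ∈ box h b ] 𝟙 (k + sum c ≡ᵇ t)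
  ≡⟨ ∑-comm (upTo (suc b)) (box h b) (λ k c → 𝟙 (k + sum c ≡ᵇ t)) ⟩
    ∑[ c ∈ box h b ] ∑[ k ∈ upTo (suc b) ] 𝟙 (k + sum c ≡ᵇ t)
  ≡⟨ ∑-cong (box h b) (λ c → ∑-upTo-𝟙 t b (sum c) t≤b) ⟩
    ∑[ c ∈ box h b ] 𝟙 (sum c ≤ᵇ t)
  ∎
  where open ≡-Reasoning

#box-zero : ∀ h b → #box h b 0 ≡ 1
#box-zero zero    b = refl
#box-zero (suc h) b = begin
  #box (suc h) b 0                 ≡⟨ #box-suc h b 0 z≤n ⟩
  ∑[ c ∈ box h b ] 𝟙 (sum c ≤ᵇ 0)  ≡⟨ ∑-cong (box h b) (𝟙-≤ᵇ-zero ∘ sum) ⟩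
  ∑[ c ∈ box h b ] 𝟙 (sum c ≡ᵇ 0)  ≡⟨ length-filterᵇ (λ c → sum c ≡ᵇ 0) (box h b) ⟨
  #box h b 0                       ≡⟨ #box-zero h b ⟩
  1                                ∎
  where open ≡-Reasoning

#box-pascal : ∀ h b t → suc t ≤ b → #box (suc h) b (suc t) ≡ #box (suc h) b t + #box h b (suc t)
#box-pascal h b t 1+t≤b = begin
    #box (suc h) b (suc t)
  ≡⟨ #box-suc h b (suc t) 1+t≤b ⟩
    ∑[ c ∈ box h b ] 𝟙 (sum c ≤ᵇ suc t)
  ≡⟨ ∑-cong (box h b) (λ c → 𝟙-≤ᵇ-suc (sum c) t) ⟩
    ∑[ c ∈ box h b ] (𝟙 (sum c ≤ᵇ t) + 𝟙 (sum c ≡ᵇ suc t))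
  ≡⟨ ∑-+ (box h b) (λ c → 𝟙 (sum c ≤ᵇ t)) (λ c → 𝟙 (sum c ≡ᵇ suc t)) ⟩
    ∑[ c ∈ box h b ] 𝟙 (sum c ≤ᵇ t) + ∑[ c ∈ box h b ] 𝟙 (sum c ≡ᵇ suc t)
  ≡⟨ cong₂ _+_ (#box-suc h b t (≤-trans (n≤1+n t) 1+t≤b))
               (length-filterᵇ (λ c → sum c ≡ᵇ suc t) (box h b)) ⟨
    #box (suc h) b t + #box h b (suc t)
  ∎
  where open ≡-Reasoning

#box-binomial : ∀ h′ b t → t ≤ b → #box (suc h′) b t ≡ (t + h′) C h′
#box-binomial h′        b zero    _     = trans (#box-zero (suc h′) b) (sym (nCn≡1 h′))
#box-binomial zero      b (suc t) 1+t≤b =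
  trans (#box-pascal 0 b t 1+t≤b) (trans (+-identityʳ _) (#box-binomial zero b t (≤-trans (n≤1+n t) 1+t≤b)))
#box-binomial (suc h′) b (suc t) 1+t≤b = begin
    #box (suc (suc h′)) b (suc t)
  ≡⟨ #box-pascal (suc h′) b t 1+t≤b ⟩
    #box (suc (suc h′)) b t + #box (suc h′) b (suc t)
  ≡⟨ cong₂ _+_ (#box-binomial (suc h′) b t (≤-trans (n≤1+n t) 1+t≤b))
               (#box-binomial h′ b (suc t) 1+t≤b) ⟩
    (t + suc h′) C suc h′ + (suc t + h′) C h′
  ≡⟨ cong (λ n → (t + suc h′) C suc h′ + n C h′) (sym (+-suc t h′)) ⟩
    (t + suc h′) C suc h′ + (t + suc h′) C h′
  ≡⟨ +-comm ((t + suc h′) C suc h′) _ ⟩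
    (t + suc h′) C h′ + (t + suc h′) C suc h′
  ≡⟨ nCk+nC[k+1]≡[n+1]C[k+1] (t + suc h′) h′ ⟩
    (suc t + suc h′) C suc h′
  ∎
  where open ≡-Reasoning

length-Ω : ∀ h′ t → length (Ω (suc h′) t) ≡ (t + h′) C h′
length-Ω h′ t = #box-binomial h′ t t ≤-refl

C-*-factorials : ∀ t h′ → ((t + h′) C h′) * (h′ ! * t !) ≡ (t + h′) !
C-*-factorials t h′ = begin
    ((t + h′) C h′) * (h′ ! * t !)
  ≡⟨ cong (λ n → ((t + h′) C h′) * (h′ ! * n !)) (m+n∸n≡m t h′) ⟨
    ((t + h′) C h′) * D
  ≡⟨ cong (_* D) (nCk≡n!/k![n-k]! h′≤t+h′) ⟩
    ((t + h′) ! / D) * D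
  ≡⟨ m/n*n≡m (k![n∸k]!∣n! h′≤t+h′) ⟩
    (t + h′) !
  ∎
  where
  open ≡-Reasoning
  h′≤t+h′ : h′ ≤ t + h′
  h′≤t+h′ = m≤n+m h′ t
  D : ℕ
  D = h′ ! * (t + h′ ∸ h′) !
  instance
    D≢0 : NonZero D
    D≢0 = h′ !* (t + h′ ∸ h′) !≢0

-- The Pólya urn and the law of V

module _ (h′ : ℕ) where
  private
    h : ℕ
    h = suc h′

  urn : Vec ℕ h → ℕ → ℕ
  urn c m = ∑[ w ∈ paths h m ] ∏! (c ⊕ endpoint w)

  urn-suc : ∀ c m → urn c (suc m) ≡ ∑[ j ∈ allFin h ] urn (c ⊕ e j) m
  urn-suc c m = begin
      ∑[ w ∈ paths h (suc m) ] ∏! (c ⊕ endpoint w)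
    ≡⟨ ∑-paths-suc m _ ⟩
      ∑[ w ∈ paths h m ] ∑[ j ∈ allFin h ] ∏! (c ⊕ (e j ⊕ endpoint w))
    ≡⟨ ∑-comm (paths h m) (allFin h) (λ w j → ∏! (c ⊕ (e j ⊕ endpoint w))) ⟩
      ∑[ j ∈ allFin h ] ∑[ w ∈ paths h m ] ∏! (c ⊕ (e j ⊕ endpoint w))
    ≡⟨ ∑-cong (allFin h) (λ j → ∑-cong (paths h m) (λ w →
         cong ∏! (sym (⊕-assoc c (e j) (endpoint w))))) ⟩
      ∑[ j ∈ allFin h ] urn (c ⊕ e j) m
    ∎
    where open ≡-Reasoning

  urn-normalization : ∀ m c s → sum c ≡ s → urn c m * (s + h′) ! ≡ ∏! c * (s + m + h′) !
  urn-normalization zero c s _ =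
    cong₂ (λ x n → x * (n + h′) !) (trans (+-identityʳ _) (cong ∏! (⊕-identityʳ c))) (sym (+-identityʳ s))
  urn-normalization (suc m) c s |c|≡s = *-cancelʳ-≡ _ _ (suc (s + h′)) (begin
      urn c (suc m) * (s + h′) ! * suc (s + h′)
    ≡⟨ *-assoc (urn c (suc m)) ((s + h′) !) _ ⟩
      urn c (suc m) * ((s + h′) ! * suc (s + h′))
    ≡⟨ cong₂ _*_ (urn-suc c m) (*-comm ((s + h′) !) _) ⟩
      ∑[ j ∈ allFin h ] urn (c ⊕ e j) m * (suc s + h′) !
    ≡⟨ ∑-*ʳ (allFin h) (λ j → urn (c ⊕ e j) m) _ ⟨
      ∑[ j ∈ allFin h ] (urn (c ⊕ e j) m * (suc s + h′) !)
    ≡⟨ ∑-cong (allFin h) (λ j →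
         urn-normalization m (c ⊕ e j) (suc s) (trans (sum-⊕e c j) (cong suc |c|≡s))) ⟩
      ∑[ j ∈ allFin h ] (∏! (c ⊕ e j) * (suc s + m + h′) !)
    ≡⟨ ∑-*ʳ (allFin h) (λ j → ∏! (c ⊕ e j)) _ ⟩
      ∑[ j ∈ allFin h ] ∏! (c ⊕ e j) * (suc s + m + h′) !
    ≡⟨ cong₂ (λ x n → x * (n + h′) !) (∑-∏!-⊕e c) (sym (+-suc s m)) ⟩
      (h + sum c) * ∏! c * (s + suc m + h′) !
    ≡⟨ cong (λ s′ → (h + s′) * ∏! c * (s + suc m + h′) !) |c|≡s ⟩
      (h + s) * ∏! c * (s + suc m + h′) !
    ≡⟨ rearrange h′ s (∏! c) _ ⟩
      ∏! c * (s + suc m + h′) ! * suc (s + h′)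
    ∎)
    where
    open ≡-Reasoning
    rearrange : ∀ h′ s p g → (suc h′ + s) * p * g ≡ p * g * suc (s + h′)
    rearrange = solve-∀

  urn-step : ∀ m c j s → sum c ≡ s → urn (c ⊕ e j) m * (s + h) ≡ suc (lookup c j) * urn c (suc m)
  urn-step m c j s |c|≡s = *-cancelʳ-≡ _ _ ((s + h′) !) {{(s + h′) !≢0}} (begin
      urn (c ⊕ e j) m * (s + h) * (s + h′) !
    ≡⟨ *-assoc (urn (c ⊕ e j) m) (s + h) _ ⟩
      urn (c ⊕ e j) m * ((s + h) * (s + h′) !)
    ≡⟨ cong (λ n → urn (c ⊕ e j) m * (n * (s + h′) !)) (+-suc s h′) ⟩
      urn (c ⊕ e j) m * (suc s + h′) !
    ≡⟨ urn-normalization m (c ⊕ e j) (suc s) (trans (sum-⊕e c j) (cong suc |c|≡s)) ⟩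
      ∏! (c ⊕ e j) * (suc s + m + h′) !
    ≡⟨ cong₂ (λ x n → x * (n + h′) !) (∏!-⊕e c j) (sym (+-suc s m)) ⟩
      suc (lookup c j) * ∏! c * (s + suc m + h′) !
    ≡⟨ *-assoc (suc (lookup c j)) (∏! c) _ ⟩
      suc (lookup c j) * (∏! c * (s + suc m + h′) !)
    ≡⟨ cong (suc (lookup c j) *_) (urn-normalization (suc m) c s |c|≡s) ⟨
      suc (lookup c j) * (urn c (suc m) * (s + h′) !)
    ≡⟨ *-assoc (suc (lookup c j)) (urn c (suc m)) _ ⟨
      suc (lookup c j) * urn c (suc m) * (s + h′) !
    ∎)
    where open ≡-Reasoning

  urn-first-step : ∀ m c j →
    ∑[ w ∈ paths h (suc m) ] (if (c ⊕ endpoint (take 1 w)) ≟ᵥ (c ⊕ e j) then ∏! (c ⊕ endpoint w) else 0)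
      ≡ urn (c ⊕ e j) m
  urn-first-step m c j = begin
      ∑[ w ∈ paths h (suc m) ] (if (c ⊕ endpoint (take 1 w)) ≟ᵥ (c ⊕ e j) then ∏! (c ⊕ endpoint w) else 0)
    ≡⟨ ∑-paths-suc m _ ⟩
      ∑[ w ∈ paths h m ] ∑[ i ∈ allFin h ]
        (if (c ⊕ (e i ⊕ replicate h 0)) ≟ᵥ (c ⊕ e j) then ∏! (c ⊕ (e i ⊕ endpoint w)) else 0)
    ≡⟨ ∑-cong (paths h m) (λ w → ∑-cong (allFin h) (λ i → cong (λ b → if b then _ else 0)
         (trans (cong (λ x → (c ⊕ x) ≟ᵥ (c ⊕ e j)) (⊕-identityʳ (e i))) (⊕e-≟ᵥ c i j)))) ⟩
      ∑[ w ∈ paths h m ] ∑[ i ∈ allFin h ] (if does (i Fin.≟ j) then ∏! (c ⊕ (e i ⊕ endpoint w)) else 0)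
    ≡⟨ ∑-cong (paths h m) (λ w → ∑-pick j (λ i → ∏! (c ⊕ (e i ⊕ endpoint w)))) ⟩
      ∑[ w ∈ paths h m ] ∏! (c ⊕ (e j ⊕ endpoint w))
    ≡⟨ ∑-cong (paths h m) (λ w → cong ∏! (sym (⊕-assoc c (e j) (endpoint w)))) ⟩
      urn (c ⊕ e j) m
    ∎
    where open ≡-Reasoning

  weight : ℕ → (Path h → Bool) → ℕ
  weight n A = ∑[ v ∈ paths h n ] (if A v then ∏! (endpoint v) else 0)

  weight-endsIn : ∀ t m c → weight (t + m) (endsIn t c) ≡ #pathsTo t c * urn c m
  weight-endsIn t m c = trans (∑-cong (paths h (t + m)) split) (∑-endsIn t m c (λ x w → ∏! (x ⊕ endpoint w)))
    where
    split : ∀ v → (if endsIn t c v then ∏! (endpoint v) else 0)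
                    ≡ (if endsIn t c v then ∏! (endpoint (take t v) ⊕ endpoint (drop t v)) else 0)
    split v = cong (λ x → if endsIn t c v then ∏! x else 0) (endpoint-take-drop t v)

  weight-endsIn-∧ : ∀ t m c j →
    weight (t + suc m) (λ v → endsIn (suc t) (c ⊕ e j) v ∧ endsIn t c v) ≡ #pathsTo t c * urn (c ⊕ e j) m
  weight-endsIn-∧ t m c j = trans (∑-cong (paths h (t + suc m)) split)
    (trans (∑-endsIn t (suc m) c next) (cong (#pathsTo t c *_) (urn-first-step m c j)))
    where
    next : Vec ℕ h → Path h → ℕ
    next x w = if (x ⊕ endpoint (take 1 w)) ≟ᵥ (c ⊕ e j) then ∏! (x ⊕ endpoint w) else 0
    split : ∀ v → (if endsIn (suc t) (c ⊕ e j) v ∧ endsIn t c v then ∏! (endpoint v) else 0)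
                    ≡ (if endsIn t c v then next (endpoint (take t v)) (drop t v) else 0)
    split v = trans (if-∧ (endsIn (suc t) (c ⊕ e j) v) (endsIn t c v) _ 0)
      (cong₂ (λ b x → if endsIn t c v then (if b then ∏! x else 0) else 0)
        (cong (_≟ᵥ (c ⊕ e j)) (trans (cong endpoint (take-suc-++ t v)) (endpoint-++ (take t v) _)))
        (endpoint-take-drop t v))

  weight-endsIn-factorial : ∀ t m c → sum c ≡ t →
                            weight (t + m) (endsIn t c) * (t + h′) ! ≡ t ! * (t + m + h′) !
  weight-endsIn-factorial t m c |c|≡t = begin
    weight (t + m) (endsIn t c) * (t + h′) ! ≡⟨ cong (_* (t + h′) !) (weight-endsIn t m c) ⟩
    #pathsTo t c * urn c m * (t + h′) !      ≡⟨ *-assoc (#pathsTo t c) _ _ ⟩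
    #pathsTo t c * (urn c m * (t + h′) !)    ≡⟨ cong (#pathsTo t c *_) (urn-normalization m c t |c|≡t) ⟩
    #pathsTo t c * (∏! c * (t + m + h′) !)   ≡⟨ *-assoc (#pathsTo t c) _ _ ⟨
    #pathsTo t c * ∏! c * (t + m + h′) !     ≡⟨ cong (_* (t + m + h′) !) (#pathsTo-multinomial t c |c|≡t) ⟩
    t ! * (t + m + h′) !                      ∎
    where open ≡-Reasoning

  weight-step : ∀ t m c j → sum c ≡ t →
    weight (t + suc m) (λ v → endsIn (suc t) (c ⊕ e j) v ∧ endsIn t c v) * (t + h)
      ≡ suc (lookup c j) * weight (t + suc m) (endsIn t c)
  weight-step t m c j |c|≡t = begin
      weight (t + suc m) (λ v → endsIn (suc t) (c ⊕ e j) v ∧ endsIn t c v) * (t + h)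
    ≡⟨ cong (_* (t + h)) (weight-endsIn-∧ t m c j) ⟩
      #pathsTo t c * urn (c ⊕ e j) m * (t + h)
    ≡⟨ *-assoc (#pathsTo t c) _ _ ⟩
      #pathsTo t c * (urn (c ⊕ e j) m * (t + h))
    ≡⟨ cong (#pathsTo t c *_) (urn-step m c j t |c|≡t) ⟩
      #pathsTo t c * (suc (lookup c j) * urn c (suc m))
    ≡⟨ *-CS.x∙yz≈y∙xz (#pathsTo t c) (suc (lookup c j)) (urn c (suc m)) ⟩
      suc (lookup c j) * (#pathsTo t c * urn c (suc m))
    ≡⟨ cong (suc (lookup c j) *_) (weight-endsIn t (suc m) c) ⟨
      suc (lookup c j) * weight (t + suc m) (endsIn t c)
    ∎
    where open ≡-Reasoning

  length-Ω-factorial : ∀ t → length (Ω h t) * (h′ ! * t !) ≡ (t + h′) !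
  length-Ω-factorial t = trans (cong (_* (h′ ! * t !)) (length-Ω h′ t)) (C-*-factorials t h′)

  instance
    length-Ω-nonZero : ∀ {t} → NonZero (length (Ω h t))
    length-Ω-nonZero {t} = nonZero-factor _ _ (length-Ω-factorial t) {{(t + h′) !≢0}}

  massV-≡ : ∀ n (v : Path h) → length v ≡ n → massV h n v ≡ frac (h′ ! * ∏! (endpoint v)) ((n + h′) !)
  massV-≡ n v |v|≡n =
    frac-cross 1 _ _ _ {{m*n≢0 _ _ {{length-Ω-nonZero}} {{#pathsTo≢0}}}} {{(n + h′) !≢0}} (begin
      1 * (n + h′) !
    ≡⟨ *-identityˡ _ ⟩
      (n + h′) !
    ≡⟨ length-Ω-factorial n ⟨
      length (Ω h n) * (h′ ! * n !)
    ≡⟨ cong (λ x → length (Ω h n) * (h′ ! * x)) (#pathsTo-multinomial n d |d|≡n) ⟨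
      length (Ω h n) * (h′ ! * (#pathsTo n d * ∏! d))
    ≡⟨ rearrange (length (Ω h n)) (h′ !) (#pathsTo n d) (∏! d) ⟩
      h′ ! * ∏! d * (length (Ω h n) * #pathsTo n d)
    ∎)
    where
    open ≡-Reasoning
    d : Vec ℕ h
    d = endpoint v
    |d|≡n : sum d ≡ n
    |d|≡n = trans (sum-endpoint v) |v|≡n
    #pathsTo≢0 : NonZero (#pathsTo n d)
    #pathsTo≢0 = nonZero-factor _ _ (#pathsTo-multinomial n d |d|≡n) {{n !≢0}}
    rearrange : ∀ o k p f → o * (k * (p * f)) ≡ k * f * (o * p)
    rearrange = solve-∀

  Pr-weight : ∀ n A → Pr h n A ≡ frac (h′ ! * weight n A) ((n + h′) !)
  Pr-weight n A = begin
      sumℚ (List.map (λ v → if A v then massV h n v else 0ℚ) (paths h n))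
    ≡⟨ cong sumℚ (Listₚ.map-cong-local (All.map term (paths-length n))) ⟩
      sumℚ (List.map (λ v → frac (h′ ! * (if A v then ∏! (endpoint v) else 0)) ((n + h′) !)) (paths h n))
    ≡⟨ sumℚ-frac ((n + h′) !) {{(n + h′) !≢0}} (paths h n) _ ⟩
      frac (∑[ v ∈ paths h n ] (h′ ! * (if A v then ∏! (endpoint v) else 0))) ((n + h′) !)
    ≡⟨ cong (λ x → frac x ((n + h′) !)) (∑-*ˡ (paths h n) _ (h′ !)) ⟩
      frac (h′ ! * weight n A) ((n + h′) !)
    ∎
    where
    open ≡-Reasoning
    term : ∀ {v} → length v ≡ n →
           (if A v then massV h n v else 0ℚ) ≡ frac (h′ ! * (if A v then ∏! (endpoint v) else 0)) ((n + h′) !)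
    term {v} |v|≡n with A v
    ... | true  = massV-≡ n v |v|≡n
    ... | false = sym (trans (cong (λ x → frac x ((n + h′) !)) (*-zeroʳ (h′ !))) (frac-0 ((n + h′) !)))

  Pr-endsIn : ∀ {n t} (c : Vec ℕ h) → t ≤ n → sum c ≡ t → Pr h n (endsIn t c) ≡ frac 1 (length (Ω h t))
  Pr-endsIn {n} {t} c t≤n |c|≡t with n ∸ t | m+[n∸m]≡n t≤n
  ... | m | refl =
    trans (Pr-weight (t + m) (endsIn t c))
          (frac-cross _ 1 _ _ {{(t + m + h′) !≢0}} (*-cancelʳ-≡ _ _ ((t + h′) !) {{(t + h′) !≢0}} (begin
      h′ ! * W * length (Ω h t) * (t + h′) !
    ≡⟨ rearrange (h′ !) W (length (Ω h t)) _ ⟩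
      h′ ! * length (Ω h t) * (W * (t + h′) !)
    ≡⟨ cong (h′ ! * length (Ω h t) *_) (weight-endsIn-factorial t m c |c|≡t) ⟩
      h′ ! * length (Ω h t) * (t ! * (t + m + h′) !)
    ≡⟨ rearrange′ (h′ !) (length (Ω h t)) (t !) _ ⟩
      length (Ω h t) * (h′ ! * t !) * (t + m + h′) !
    ≡⟨ cong (_* (t + m + h′) !) (length-Ω-factorial t) ⟩
      (t + h′) ! * (t + m + h′) !
    ≡⟨ rearrange″ ((t + h′) !) _ ⟩
      1 * (t + m + h′) ! * (t + h′) !
    ∎)))
    where
    open ≡-Reasoning
    W : ℕ
    W = weight (t + m) (endsIn t c)
    rearrange : ∀ k w o g → k * w * o * g ≡ k * o * (w * g)
    rearrange = solve-∀
    rearrange′ : ∀ k o f g → k * o * (f * g) ≡ o * (k * f) * g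
    rearrange′ = solve-∀
    rearrange″ : ∀ g g′ → g * g′ ≡ 1 * g′ * g
    rearrange″ = solve-∀

  Pr-endsIn-∧ : ∀ t m c j → sum c ≡ t →
    Pr h (t + suc m) (λ v → endsIn (suc t) (c ⊕ e j) v ∧ endsIn t c v)
      ≡ frac (suc (lookup c j)) (t + h) ℚ.* Pr h (t + suc m) (endsIn t c)
  Pr-endsIn-∧ t m c j |c|≡t = begin
      Pr h (t + suc m) A∧B
    ≡⟨ Pr-weight (t + suc m) A∧B ⟩
      frac (h′ ! * weight (t + suc m) A∧B) G
    ≡⟨ frac-cross _ _ _ _ {{G≢0}} {{m*n≢0 (t + h) G {{t+h≢0}} {{G≢0}}}} (begin
         h′ ! * weight (t + suc m) A∧B * ((t + h) * G)
       ≡⟨ rearrange (h′ !) _ (t + h) G ⟩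
         h′ ! * (weight (t + suc m) A∧B * (t + h)) * G
       ≡⟨ cong (λ x → h′ ! * x * G) (weight-step t m c j |c|≡t) ⟩
         h′ ! * (suc (lookup c j) * weight (t + suc m) B) * G
       ≡⟨ cong (_* G) (*-CS.x∙yz≈y∙xz (h′ !) (suc (lookup c j)) _) ⟩
         suc (lookup c j) * (h′ ! * weight (t + suc m) B) * G
       ∎) ⟩
      frac (suc (lookup c j) * (h′ ! * weight (t + suc m) B)) ((t + h) * G)
    ≡⟨ frac-* _ _ (t + h) G {{t+h≢0}} {{G≢0}} ⟨
      frac (suc (lookup c j)) (t + h) ℚ.* frac (h′ ! * weight (t + suc m) B) G
    ≡⟨ cong (frac (suc (lookup c j)) (t + h) ℚ.*_) (Pr-weight (t + suc m) B) ⟨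
      frac (suc (lookup c j)) (t + h) ℚ.* Pr h (t + suc m) B
    ∎
    where
    open ≡-Reasoning
    B A∧B : Path h → Bool
    B = endsIn t c
    A∧B v = endsIn (suc t) (c ⊕ e j) v ∧ B v
    G : ℕ
    G = (t + suc m + h′) !
    G≢0 : NonZero G
    G≢0 = (t + suc m + h′) !≢0
    t+h≢0 : NonZero (t + h)
    t+h≢0 = ≢-nonZero (m+1+n≢0 t)
    rearrange : ∀ k w s g → k * w * (s * g) ≡ k * (w * s) * g
    rearrange = solve-∀

  PrCond-endsIn : ∀ {n t} (c : Vec ℕ h) j → t < n → sum c ≡ t →
    PrCond h n (endsIn (suc t) (c ⊕ e j)) (endsIn t c) ≡ frac (suc (lookup c j)) (t + h)
  PrCond-endsIn {n} {t} c j t<n |c|≡t with n ∸ suc t | m+[n∸m]≡n t<n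
  ... | m | refl = subst (λ n → PrCond h n (endsIn (suc t) (c ⊕ e j)) (endsIn t c) ≡ frac (suc (lookup c j)) (t + h))
                     (+-suc t m)
    (PrCond-≡ (t + suc m) _ _ _ PrB≢0 (Pr-endsIn-∧ t m c j |c|≡t))
    where
    PrB≢0 : Pr h (t + suc m) (endsIn t c) ≢ 0ℚ
    PrB≢0 PrB≡0 = frac-1≢0 (length (Ω h t)) (trans (sym (Pr-endsIn c (m≤m+n t (suc m)) |c|≡t)) PrB≡0)

lemma3p1 : (h n : ℕ) → 1 ≤ h → (t : ℕ) → t ≤ n → (c : Vec ℕ h) → c ∈Ω t →
    (Pr h n (endsIn t c) ≡ frac 1 (length (Ω h t))
      × frac 1 (length (Ω h t)) ≡ frac 1 ((t + h ∸ 1) C (h ∸ 1)))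
    × (t < n → (j : Fin h) →
        PrCond h n (endsIn (suc t) (zipWith _+_ c (e j))) (endsIn t c)
          ≡ frac (suc (lookup c j)) (t + h))
lemma3p1 (suc h′) n _ t t≤n c |c|≡t =
    ( Pr-endsIn h′ c t≤n |c|≡t
    , cong (frac 1) (trans (length-Ω h′ t) (cong (λ k → (k ∸ 1) C h′) (sym (+-suc t h′)))) )
  , λ t<n j → PrCond-endsIn h′ c j t<n |c|≡t
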